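{- Let $G$ be a finite bipartite graph, let $u,v\in V(G)$ and let $x$ be a positive real number. Then \begin{itemize} \item $I(G-u,x)I(G-v,x)-I(G,x)I(G-u-v,x)>0$ if $d_G(u,v)$ is odd; \item $I(G-u,x)I(G-v,x)-I(G,x)I(G-u-v,x)=0$ if $d_G(u,v)=\infty$; \item $I(G-u,x)I(G-v,x)-I(G,x)I(G-u-v,x)<0$ if $d_G(u,v)$ is even. \end{itemize}
   Context: For a graph $G$, the independence polynomial is $I(G,x)=\sum_{k\ge 0}a_k(G)x^k$, where $a_0(G)=1$ and for $k\ge1$, $a_k(G)$ is the number of independent sets of $G$ of size $k$. For $S\subseteq V(G)$, $G-S$ denotes the induced subgraph on $V(G)\setminus S$; $G-u$ and $G-u-v$ mean $G-\{u\}$ and $G-\{u,v\}$. $d_G(u,v)$ is the length of a shortest walk from $u$ to $v$ in $G$ if one exists, and $\infty$ otherwise. -}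

module Defs where

open import Level using (Level; _⊔_) renaming (suc to lsuc)
open import Data.Bool using (Bool; true; false; _∧_; _∨_; not; if_then_else_)
open import Data.Nat using (ℕ; zero; suc)
open import Data.Fin using (Fin)
open import Data.Vec using (Vec; []; _∷_)
open import Data.List using (List; []; _∷_; map; _++_; filterᵇ; length; allFin; upTo; foldr)
import Data.Bool.ListAction as L
open import Data.Fin.Subset using (Subset; _∈_; ⁅_⁆; _∪_; ∁; ⊤)
open import Data.Fin.Subset.Properties using (_∈?_)
open import Data.Product using (Σ; ∃; _×_; _,_)
open import Relation.Binary.PropositionalEquality using (_≡_)
open import Relation.Nullary using (¬_)
open import Relation.Nullary.Decidable using (⌊_⌋)
open import Algebra.Bundles using (CommutativeRing)
import Algebra.Bundles
open import Relation.Binary.Structures using (IsStrictTotalOrder)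
import Algebra.Definitions.RawSemiring as RS

record Graph (n : ℕ) : Set where
  field
    adj     : Fin n → Fin n → Bool
    adj-sym : ∀ u v → adj u v ≡ adj v u
    adj-irr : ∀ u → adj u u ≡ false
open Graph public

Bipartite : ∀ {n} → Graph n → Set
Bipartite {n} G = Σ (Fin n → Bool) λ c → ∀ u v → adj G u v ≡ true → ¬ (c u ≡ c v)

data Walk {n} (G : Graph n) : Fin n → Fin n → ℕ → Set where
  nil  : ∀ {u} → Walk G u u 0
  cons : ∀ {u w v k} → adj G u w ≡ true → Walk G w v k → Walk G u v (suc k)

Dist : ∀ {n} → Graph n → Fin n → Fin n → ℕ → Set
Dist G u v d = Walk G u v d × (∀ k → Walk G u v k → d Data.Nat.≤ k)

DistInfinite : ∀ {n} → Graph n → Fin n → Fin n → Set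
DistInfinite G u v = ¬ (∃ λ k → Walk G u v k)

allSubsets : (n : ℕ) → List (Subset n)
allSubsets zero    = [] ∷ []
allSubsets (suc n) = map (false ∷_) (allSubsets n) ++ map (true ∷_) (allSubsets n)

isIndependent : ∀ {n} → Graph n → Subset n → Bool
isIndependent {n} G T =
  L.all (λ u → L.all (λ v →
    not (⌊ u ∈? T ⌋ ∧ ⌊ v ∈? T ⌋ ∧ adj G u v)) (allFin n)) (allFin n)

avoids : ∀ {n} → Subset n → Subset n → Bool
avoids {n} S T = L.all (λ u → not (⌊ u ∈? T ⌋ ∧ ⌊ u ∈? S ⌋)) (allFin n)

card : ∀ {n} → Subset n → ℕ
card [] = 0
card (true ∷ T) = suc (card T)
card (false ∷ T) = card T

-- a_k(G - S): number of independent sets of size k of the induced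
-- subgraph G - S, i.e. independent sets of G disjoint from S
-- (a_0 = 1, realised by the empty set)
indepCount : ∀ {n} → Graph n → Subset n → ℕ → ℕ
indepCount {n} G S k =
  length (filterᵇ (λ T → isIndependent G T ∧ avoids S T ∧ (card T Data.Nat.≡ᵇ k))
                  (allSubsets n))

-- Ordered commutative rings (the positive reals live in one)

record OrderedCommRing (c ℓ₁ ℓ₂ : Level) : Set (lsuc (c ⊔ ℓ₁ ⊔ ℓ₂)) where
  field
    commutativeRing : CommutativeRing c ℓ₁
  open CommutativeRing commutativeRing public
  field
    _<_                : Carrier → Carrier → Set ℓ₂
    isStrictTotalOrder : IsStrictTotalOrder _≈_ _<_
    +-mono-<           : ∀ {x y} z → x < y → (x + z) < (y + z)
    *-pos              : ∀ {x y} → 0# < x → 0# < y → 0# < (x * y)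

module _ {c ℓ₁ ℓ₂} (R : OrderedCommRing c ℓ₁ ℓ₂) where
  open OrderedCommRing R
  open RS (Algebra.Bundles.Semiring.rawSemiring semiring) using (_^_) renaming (_×_ to _·ℕ_)

  indepPoly : ∀ {n} → Graph n → Subset n → Carrier → Carrier
  indepPoly {n} G S x = foldr _+_ 0# (map (λ k → indepCount G S k ·ℕ (x ^ k)) (upTo (suc n)))

module Submission where

-- Write Δ_S(u,v) = I(G−S−u)I(G−S−v) − I(G−S)I(G−S−u−v). By induction on the deleted set S, Δ_S(u,v)
-- is positive if u and v have different colours and negative otherwise when v is reachable from u in
-- G − S, and vanishes when it is not; S = ∅ gives the theorem, as walks between vertices of different
-- colours have odd length.
-- The recurrence I(H) = I(H−w) + x·I(H−N[w]) gives Δ_S(u,u) = −x·I(G−S−u)·I(G−S−N[u]) < 0. For u ≠ v,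
-- applying it at u to G−S and to G−S−v gives Δ_S(u,v) = x·(f(A)g(B) − f(B)g(A)) with A = S ∪ {u},
-- B = A ∪ N(u), f(T) = I(G−T) and g(T) = I(G−T−v). Inserting the neighbours t of u into A one at a
-- time changes this cross difference by −Δ_a(t,v), which by induction has the sign opposite to that
-- of the pair t, v, that is, the sign of the pair u, v; since f > 0 these signs accumulate. If v is
-- reachable, inserting first the neighbour through which a u–v walk last leaves u makes one step strict.

open import Defs
open import Level using (Level; _⊔_)
open import Data.Bool using (Bool; true; false; not; _∧_; _xor_; T)
open import Data.Bool.Properties using (T-∧; T-not-≡; T-≡; not-distribˡ-xor; xor-same; ¬-not; not-involutive)
import Data.Bool.ListAction as L
open import Data.Nat as ℕ using (ℕ; zero; suc; _≤_; _≡ᵇ_; _%_; s≤s; z≤n)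
open import Data.Nat.Properties as ℕₚ using (≡ᵇ⇒≡; ≡⇒≡ᵇ; m≤m+n; ≤-trans; suc-injective)
open import Data.Fin using (Fin; zero; suc; _≟_; toℕ; inject₁; fromℕ)
open import Data.Fin.Properties using (toℕ-inject₁; toℕ-fromℕ)
open import Data.Fin.Subset using (Subset; _∈_; _∉_; _∪_; ⁅_⁆; _⊆_; _⊃_; ∣_∣) renaming (⊥ to ∅)
open import Data.Fin.Subset.Properties
  using (_∈?_; ∉⊥; ∈⊤; x∈⁅x⁆; x∈⁅y⁆⇒x≡y; x∈p∪q⁺; x∈p∪q⁻; ∣p∣≡n⇒p≡⊤; ∣⊥∣≡0; ⊆-refl; ⊆-antisym; ⊆-trans; p⊆p∪q;
         ∪-assoc; ∪-identityˡ; ∪-commutativeMonoid)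
open import Data.Fin.Subset.Induction using (⊃-wellFounded)
open import Data.List using (List; []; _∷_; _++_; map; foldr; filterᵇ; length; allFin; applyUpTo)
open import Data.List.Properties using (filter-++; length-++)
open import Data.List.Membership.Propositional using () renaming (_∈_ to _∈ₗ_)
open import Data.List.Membership.Propositional.Properties using (∈-filter⁺; ∈-filter⁻; ∈-allFin)
open import Data.List.Relation.Unary.Any using (here; there)
open import Data.List.Relation.Unary.All.Properties using (all⁺; all⁻; tabulate⁺; tabulate⁻)
open import Data.Vec using ([]; _∷_; tabulate; here; there)
open import Data.Vec.Properties using ([]=⇒lookup; lookup⇒[]=; lookup∘tabulate)
open import Data.Vec.Functional using (Vector)
open import Data.Product using (_×_; _,_; ∃; ∃-syntax; proj₁; proj₂)
open import Data.Sum using (_⊎_; inj₁; inj₂; [_,_])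
open import Data.Empty using (⊥-elim)
open import Function using (_∘_; id; _⇔_; mk⇔; Equivalence; case_of_)
open import Induction.WellFounded using (module All)
open import Relation.Nullary using (¬_; yes; no; Dec; contradiction)
open import Relation.Nullary.Decidable using (isYes; T?)
open import Relation.Binary.Definitions using (tri<; tri≈; tri>)
open import Relation.Binary.Structures using (IsStrictTotalOrder)
open import Relation.Binary.PropositionalEquality as ≡
  using (_≡_; _≢_; refl; sym; trans; cong; cong₂; subst; module ≡-Reasoning)
import Algebra.Bundles
import Algebra.Properties.CommutativeSemigroup as CommutativeSemigroupProperties

private
  variable
    A B : Set
    n : ℕ

¬T⇒≡false : ∀ {b} → ¬ T b → b ≡ false
¬T⇒≡false {true}  ¬T = contradiction _ ¬T
¬T⇒≡false {false} _  = refl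

T-not-∧ : (a? : Dec A) (b? : Dec B) → T (not (isYes a? ∧ isYes b?)) ⇔ (A → ¬ B)
T-not-∧ (yes a) (yes b) = mk⇔ (λ ()) (λ h → h a b)
T-not-∧ (yes a) (no ¬b) = mk⇔ (λ _ _ → ¬b) _
T-not-∧ (no ¬a) b?      = mk⇔ (λ _ a → contradiction a ¬a) _

T-not-∧∧ : (a? : Dec A) (b? : Dec B) (c : Bool) → T (not (isYes a? ∧ isYes b? ∧ c)) ⇔ (A → B → c ≡ false)
T-not-∧∧ (yes a) (yes b) c = mk⇔ (λ h _ _ → Equivalence.to T-not-≡ h) (λ h → Equivalence.from T-not-≡ (h a b))
T-not-∧∧ (yes a) (no ¬b) c = mk⇔ (λ _ _ b → contradiction b ¬b) _
T-not-∧∧ (no ¬a) b?      c = mk⇔ (λ _ a → contradiction a ¬a) _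

T-all-allFin : ∀ (p : Fin n → Bool) → T (L.all p (allFin n)) ⇔ (∀ i → T (p i))
T-all-allFin p = mk⇔ (tabulate⁻ ∘ all⁺ p (allFin _)) (all⁻ p ∘ tabulate⁺)

T-injective : ∀ {a b} → (T a ⇔ T b) → a ≡ b
T-injective {true}  {true}  _ = refl
T-injective {false} {false} _ = refl
T-injective {true}  {false} h = ⊥-elim (Equivalence.to h _)
T-injective {false} {true}  h = ⊥-elim (Equivalence.from h _)

count : (A → Bool) → List A → ℕ
count p xs = length (filterᵇ p xs)

count-++ : ∀ (p : A → Bool) xs ys → count p (xs ++ ys) ≡ count p xs ℕ.+ count p ys
count-++ p xs ys = trans (cong length (filter-++ (T? ∘ p) xs ys)) (length-++ (filterᵇ p xs))

count-map : ∀ (p : B → Bool) (f : A → B) xs → count p (map f xs) ≡ count (p ∘ f) xs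
count-map p f []       = refl
count-map p f (x ∷ xs) with p (f x)
... | true  = cong suc (count-map p f xs)
... | false = count-map p f xs

count-cong : ∀ {p q : A → Bool} xs → (∀ x → p x ≡ q x) → count p xs ≡ count q xs
count-cong []                 p≗q = refl
count-cong {p = p} {q} (x ∷ xs) p≗q with p x | q x | p≗q x
... | true  | true  | refl = cong suc (count-cong xs p≗q)
... | false | false | refl = count-cong xs p≗q

count-none : ∀ {p : A → Bool} xs → (∀ x → p x ≡ false) → count p xs ≡ 0
count-none []                 _ = refl
count-none {p = p} (x ∷ xs) none with p x | none x
... | false | refl = count-none xs none

count-split : ∀ (q p : A → Bool) xs →
  count p xs ≡ count (λ x → not (q x) ∧ p x) xs ℕ.+ count (λ x → q x ∧ p x) xs
count-split q p []       = refl
count-split q p (x ∷ xs) with q x | p x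
... | true  | true  = trans (cong suc (count-split q p xs)) (sym (ℕₚ.+-suc _ _))
... | true  | false = count-split q p xs
... | false | true  = cong suc (count-split q p xs)
... | false | false = count-split q p xs

countSubsets : (n : ℕ) → (Subset n → Bool) → ℕ
countSubsets n p = count p (allSubsets n)

countSubsets-suc : ∀ n (p : Subset (suc n) → Bool) →
  countSubsets (suc n) p ≡ countSubsets n (p ∘ (false ∷_)) ℕ.+ countSubsets n (p ∘ (true ∷_))
countSubsets-suc n p =
  trans (count-++ p (map (false ∷_) (allSubsets n)) _)
        (cong₂ ℕ._+_ (count-map p _ (allSubsets n)) (count-map p _ (allSubsets n)))

countSubsets-∅ : ∀ n (p : Subset n → Bool) → T (p ∅) → 1 ≤ countSubsets n p
countSubsets-∅ zero    p p∅ with p []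
... | true = s≤s z≤n
countSubsets-∅ (suc n) p p∅ rewrite countSubsets-suc n p =
  ≤-trans (countSubsets-∅ n (p ∘ (false ∷_)) p∅) (m≤m+n _ _)

toggle : Fin n → Subset n → Subset n
toggle zero    (b ∷ p) = not b ∷ p
toggle (suc w) (b ∷ p) = b ∷ toggle w p

countSubsets-toggle : ∀ n w (p : Subset n → Bool) → countSubsets n (p ∘ toggle w) ≡ countSubsets n p
countSubsets-toggle (suc n) zero p = begin
  countSubsets (suc n) (p ∘ toggle zero)                      ≡⟨ countSubsets-suc n (p ∘ toggle zero) ⟩
  countSubsets n (p ∘ (true ∷_)) ℕ.+ countSubsets n (p ∘ (false ∷_)) ≡⟨ ℕₚ.+-comm (countSubsets n (p ∘ (true ∷_))) _ ⟩
  countSubsets n (p ∘ (false ∷_)) ℕ.+ countSubsets n (p ∘ (true ∷_)) ≡⟨ countSubsets-suc n p ⟨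
  countSubsets (suc n) p                                      ∎
  where open ≡-Reasoning
countSubsets-toggle (suc n) (suc w) p = begin
  countSubsets (suc n) (p ∘ toggle (suc w))
    ≡⟨ countSubsets-suc n (p ∘ toggle (suc w)) ⟩
  countSubsets n (p ∘ (false ∷_) ∘ toggle w) ℕ.+ countSubsets n (p ∘ (true ∷_) ∘ toggle w)
    ≡⟨ cong₂ ℕ._+_ (countSubsets-toggle n w (p ∘ (false ∷_))) (countSubsets-toggle n w (p ∘ (true ∷_))) ⟩
  countSubsets n (p ∘ (false ∷_)) ℕ.+ countSubsets n (p ∘ (true ∷_))
    ≡⟨ countSubsets-suc n p ⟨
  countSubsets (suc n) p
    ∎
  where open ≡-Reasoning

∈-toggle⁻ : ∀ {i w} {p : Subset n} → i ≢ w → i ∈ toggle w p → i ∈ p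
∈-toggle⁻ {i = zero}  {zero}  i≢w _ = contradiction refl i≢w
∈-toggle⁻ {i = zero}  {suc w} {true ∷ p} _ here = here
∈-toggle⁻ {i = suc i} {zero}  {b ∷ p} _ (there i∈p) = there i∈p
∈-toggle⁻ {i = suc i} {suc w} {b ∷ p} i≢w (there i∈t) = there (∈-toggle⁻ (i≢w ∘ cong suc) i∈t)

∈-toggle⁺ : ∀ {i w} {p : Subset n} → i ≢ w → i ∈ p → i ∈ toggle w p
∈-toggle⁺ {i = zero}  {zero}  i≢w _ = contradiction refl i≢w
∈-toggle⁺ {i = zero}  {suc w} {true ∷ p} _ here = here
∈-toggle⁺ {i = suc i} {zero}  {b ∷ p} _ (there i∈p) = there i∈p
∈-toggle⁺ {i = suc i} {suc w} {b ∷ p} i≢w (there i∈p) = there (∈-toggle⁺ (i≢w ∘ cong suc) i∈p)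

toggle-∉ : ∀ {w} {p : Subset n} → w ∈ p → w ∉ toggle w p
toggle-∉ {w = zero}  here ()
toggle-∉ {w = suc w} {b ∷ p} (there w∈p) (there w∈t) = toggle-∉ w∈p w∈t

toggle-∈ : ∀ {w} {p : Subset n} → w ∉ p → w ∈ toggle w p
toggle-∈ {w = zero}  {true ∷ p}  w∉p = contradiction here w∉p
toggle-∈ {w = zero}  {false ∷ p} w∉p = here
toggle-∈ {w = suc w} {b ∷ p}     w∉p = there (toggle-∈ (w∉p ∘ there))

card-toggle : ∀ {w} {p : Subset n} → w ∈ p → suc (card (toggle w p)) ≡ card p
card-toggle {w = zero}  here = refl
card-toggle {w = suc w} {true ∷ p}  (there w∈p) = cong suc (card-toggle w∈p)
card-toggle {w = suc w} {false ∷ p} (there w∈p) = card-toggle w∈p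

card≡∣∣ : ∀ (p : Subset n) → card p ≡ ∣ p ∣
card≡∣∣ []          = refl
card≡∣∣ (true ∷ p)  = cong suc (card≡∣∣ p)
card≡∣∣ (false ∷ p) = card≡∣∣ p

p⊆q⇒q∪p≡q : ∀ {p q : Subset n} → p ⊆ q → q ∪ p ≡ q
p⊆q⇒q∪p≡q {p = p} {q} p⊆q = ⊆-antisym (λ x∈ → [ id , p⊆q ] (x∈p∪q⁻ q p x∈)) (p⊆p∪q p)

∈⇒∪⁅⁆≡ : ∀ {t} {a : Subset n} → t ∈ a → a ∪ ⁅ t ⁆ ≡ a
∈⇒∪⁅⁆≡ {t = t} t∈a = p⊆q⇒q∪p≡q λ i∈t → subst (_∈ _) (sym (x∈⁅y⁆⇒x≡y t i∈t)) t∈a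

∉∪⁅⁆ : ∀ {i t} {a : Subset n} → i ∉ a → i ≢ t → i ∉ a ∪ ⁅ t ⁆
∉∪⁅⁆ {t = t} {a} i∉a i≢t i∈ = [ i∉a , i≢t ∘ x∈⁅y⁆⇒x≡y t ] (x∈p∪q⁻ a ⁅ t ⁆ i∈)

insertAll : List (Fin n) → Subset n → Subset n
insertAll []       a = a
insertAll (t ∷ ts) a = insertAll ts (a ∪ ⁅ t ⁆)

∈-insertAll⁺ˡ : ∀ {i} ts {a : Subset n} → i ∈ a → i ∈ insertAll ts a
∈-insertAll⁺ˡ []       i∈a = i∈a
∈-insertAll⁺ˡ (t ∷ ts) i∈a = ∈-insertAll⁺ˡ ts (x∈p∪q⁺ (inj₁ i∈a))

∈-insertAll⁺ʳ : ∀ {i ts} {a : Subset n} → i ∈ₗ ts → i ∈ insertAll ts a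
∈-insertAll⁺ʳ {ts = t ∷ ts} (here refl) = ∈-insertAll⁺ˡ ts (x∈p∪q⁺ (inj₂ (x∈⁅x⁆ t)))
∈-insertAll⁺ʳ {ts = t ∷ ts} (there i∈) = ∈-insertAll⁺ʳ i∈

∈-insertAll⁻ : ∀ {i} ts {a : Subset n} → i ∈ insertAll ts a → i ∈ a ⊎ i ∈ₗ ts
∈-insertAll⁻ []            i∈ = inj₁ i∈
∈-insertAll⁻ (t ∷ ts) {a} i∈ with ∈-insertAll⁻ ts i∈
... | inj₂ i∈ts = inj₂ (there i∈ts)
... | inj₁ i∈a∪t with x∈p∪q⁻ a ⁅ t ⁆ i∈a∪t
...   | inj₁ i∈a = inj₁ i∈a
...   | inj₂ i∈t = inj₂ (here (x∈⁅y⁆⇒x≡y t i∈t))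

∪-swapʳ : ∀ (p q r : Subset n) → (p ∪ q) ∪ r ≡ (p ∪ r) ∪ q
∪-swapʳ {n} = CommutativeSemigroupProperties.xy∙z≈xz∙y
  (Algebra.Bundles.CommutativeMonoid.commutativeSemigroup (∪-commutativeMonoid n))

module _ (G : Graph n) where

  neighbours : Fin n → Subset n
  neighbours w = tabulate (adj G w)

  closedNeighbours : Fin n → Subset n
  closedNeighbours w = ⁅ w ⁆ ∪ neighbours w

  ∈neighbours⇔adj : ∀ {i w} → i ∈ neighbours w ⇔ adj G w i ≡ true
  ∈neighbours⇔adj {i} {w} = mk⇔ (λ i∈N → trans (sym (lookup∘tabulate (adj G w) i)) ([]=⇒lookup i∈N))
                       (λ adj≡ → lookup⇒[]= i _ (trans (lookup∘tabulate (adj G w) i) adj≡))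

  Independent : Subset n → Set
  Independent T = ∀ {u v} → u ∈ T → v ∈ T → adj G u v ≡ false

  record IsIndependentSet (S : Subset n) (k : ℕ) (T : Subset n) : Set where
    field
      independent : Independent T
      disjoint    : ∀ {i} → i ∈ T → i ∉ S
      size        : card T ≡ k

  isIndependentSet? : Subset n → ℕ → Subset n → Bool
  isIndependentSet? S k T = isIndependent G T ∧ avoids S T ∧ (card T ≡ᵇ k)

  T-isIndependent : ∀ T′ → T (isIndependent G T′) ⇔ Independent T′
  T-isIndependent T′ = mk⇔
    (λ h {u} {v} u∈ v∈ → Equivalence.to (T-not-∧∧ (u ∈? T′) (v ∈? T′) (adj G u v))
        (Equivalence.to (T-all-allFin {n} _) (Equivalence.to (T-all-allFin {n} _) h u) v) u∈ v∈)
    (λ ind → Equivalence.from (T-all-allFin {n} _) λ u → Equivalence.from (T-all-allFin {n} _) λ v →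
        Equivalence.from (T-not-∧∧ (u ∈? T′) (v ∈? T′) (adj G u v)) ind)

  T-avoids : ∀ S T′ → T (avoids S T′) ⇔ (∀ {i} → i ∈ T′ → i ∉ S)
  T-avoids S T′ = mk⇔
    (λ h {i} → Equivalence.to (T-not-∧ (i ∈? T′) (i ∈? S)) (Equivalence.to (T-all-allFin {n} _) h i))
    (λ h → Equivalence.from (T-all-allFin {n} _) λ i → Equivalence.from (T-not-∧ (i ∈? T′) (i ∈? S)) h)

  isIndependentSet?-sound : ∀ {S k T′} → T (isIndependentSet? S k T′) → IsIndependentSet S k T′
  isIndependentSet?-sound {S} {k} {T′} h =
    let ind , rest = Equivalence.to T-∧ h
        avo , siz  = Equivalence.to T-∧ rest
    in record { independent = Equivalence.to (T-isIndependent T′) ind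
              ; disjoint    = Equivalence.to (T-avoids S T′) avo
              ; size        = ≡ᵇ⇒≡ (card T′) k siz }

  isIndependentSet?-complete : ∀ {S k T′} → IsIndependentSet S k T′ → T (isIndependentSet? S k T′)
  isIndependentSet?-complete {S} {k} {T′} is = Equivalence.from T-∧
    ( Equivalence.from (T-isIndependent T′) (IsIndependentSet.independent is)
    , Equivalence.from T-∧ ( Equivalence.from (T-avoids S T′) (IsIndependentSet.disjoint is)
                           , ≡⇒≡ᵇ (card T′) k (IsIndependentSet.size is)))

  open IsIndependentSet

  card≡0⇒∉ : ∀ {w} {T′ : Subset n} → card T′ ≡ 0 → w ∉ T′
  card≡0⇒∉ card≡0 w∈T = case trans (card-toggle w∈T) card≡0 of λ ()

  IsIndependentSet-∪⁅⁆⁺ : ∀ {S k T′ w} → IsIndependentSet S k T′ → w ∉ T′ → IsIndependentSet (S ∪ ⁅ w ⁆) k T′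
  IsIndependentSet-∪⁅⁆⁺ {S} {T′ = T′} {w} is w∉T = record
    { independent = independent is
    ; disjoint    = λ i∈T i∈S∪w → case x∈p∪q⁻ S ⁅ w ⁆ i∈S∪w of λ where
        (inj₁ i∈S) → disjoint is i∈T i∈S
        (inj₂ i∈w) → w∉T (subst (_∈ T′) (x∈⁅y⁆⇒x≡y w i∈w) i∈T)
    ; size        = size is }

  IsIndependentSet-∪⁻ : ∀ {S S′ k T′} → IsIndependentSet (S ∪ S′) k T′ → IsIndependentSet S k T′
  IsIndependentSet-∪⁻ is = record
    { independent = independent is
    ; disjoint    = λ i∈T i∈S → disjoint is i∈T (x∈p∪q⁺ (inj₁ i∈S))
    ; size        = size is }

  IsIndependentSet-∉ : ∀ {S k T′ i} → IsIndependentSet S k T′ → i ∈ S → i ∉ T′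
  IsIndependentSet-∉ is i∈S i∈T = disjoint is i∈T i∈S

  w∈closedNeighbours : ∀ w → w ∈ closedNeighbours w
  w∈closedNeighbours w = x∈p∪q⁺ (inj₁ (x∈⁅x⁆ w))

  IsIndependentSet-toggle⁺ : ∀ {S j T′ w} → w ∈ T′ →
    IsIndependentSet S (suc j) T′ → IsIndependentSet (S ∪ closedNeighbours w) j (toggle w T′)
  IsIndependentSet-toggle⁺ {S} {j} {T′} {w} w∈T is = record
    { independent = λ u∈ v∈ → independent is (shrink u∈) (shrink v∈)
    ; disjoint    = λ {i} i∈ i∈S∪N[w] → case x∈p∪q⁻ S (closedNeighbours w) i∈S∪N[w] of λ where
        (inj₁ i∈S)    → disjoint is (shrink i∈) i∈S
        (inj₂ i∈N[w]) → case x∈p∪q⁻ ⁅ w ⁆ (neighbours w) i∈N[w] of λ where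
          (inj₁ i∈w) → toggle-∉ w∈T (subst (_∈ toggle w T′) (x∈⁅y⁆⇒x≡y w i∈w) i∈)
          (inj₂ i∈N) → case trans (sym (independent is w∈T (shrink i∈))) (Equivalence.to ∈neighbours⇔adj i∈N) of λ ()
    ; size        = suc-injective (trans (card-toggle w∈T) (size is)) }
    where
    shrink : ∀ {i} → i ∈ toggle w T′ → i ∈ T′
    shrink {i} i∈ = ∈-toggle⁻ (λ i≡w → toggle-∉ w∈T (subst (_∈ toggle w T′) i≡w i∈)) i∈

  IsIndependentSet-toggle⁻ : ∀ {S j T′ w} → w ∉ S →
    IsIndependentSet (S ∪ closedNeighbours w) j (toggle w T′) → w ∈ T′ × IsIndependentSet S (suc j) T′
  IsIndependentSet-toggle⁻ {S} {j} {T′} {w} w∉S is = w∈T , record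
    { independent = independentT
    ; disjoint    = λ {i} i∈T i∈S → case i ≟ w of λ where
        (yes refl) → w∉S i∈S
        (no i≢w)   → disjoint is (∈-toggle⁺ i≢w i∈T) (x∈p∪q⁺ (inj₁ i∈S))
    ; size        = trans (sym (card-toggle w∈T)) (cong suc (size is)) }
    where
    w∉T′ : w ∉ toggle w T′
    w∉T′ = IsIndependentSet-∉ is (x∈p∪q⁺ (inj₂ (w∈closedNeighbours w)))
    w∈T : w ∈ T′
    w∈T = case w ∈? T′ of λ where
      (yes w∈T) → w∈T
      (no w∉T)  → contradiction (toggle-∈ w∉T) w∉T′
    adj-w : ∀ {v} → v ≢ w → v ∈ T′ → adj G w v ≡ false
    adj-w v≢w v∈T = ¬T⇒≡false λ adj-wv → IsIndependentSet-∉ is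
      (x∈p∪q⁺ (inj₂ (x∈p∪q⁺ (inj₂ (Equivalence.from ∈neighbours⇔adj (Equivalence.to T-≡ adj-wv)))))) (∈-toggle⁺ v≢w v∈T)
    independentT : Independent T′
    independentT {u} {v} u∈T v∈T with u ≟ w | v ≟ w
    ... | yes refl | yes refl = adj-irr G w
    ... | yes refl | no v≢w   = adj-w v≢w v∈T
    ... | no u≢w   | yes refl = trans (adj-sym G u w) (adj-w u≢w u∈T)
    ... | no u≢w   | no v≢w   = independent is (∈-toggle⁺ u≢w u∈T) (∈-toggle⁺ v≢w v∈T)

  isIndependentSet?-∉ : ∀ {S k} w T′ →
    not (isYes (w ∈? T′)) ∧ isIndependentSet? S k T′ ≡ isIndependentSet? (S ∪ ⁅ w ⁆) k T′
  isIndependentSet?-∉ w T′ with w ∈? T′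
  ... | yes w∈T = sym (¬T⇒≡false λ h →
    IsIndependentSet-∉ (isIndependentSet?-sound h) (x∈p∪q⁺ (inj₂ (x∈⁅x⁆ w))) w∈T)
  ... | no w∉T  = T-injective (mk⇔
    (λ h → isIndependentSet?-complete (IsIndependentSet-∪⁅⁆⁺ (isIndependentSet?-sound h) w∉T))
    (λ h → isIndependentSet?-complete (IsIndependentSet-∪⁻ (isIndependentSet?-sound h))))

  isIndependentSet?-∈-size0 : ∀ {S} w T′ → isYes (w ∈? T′) ∧ isIndependentSet? S 0 T′ ≡ false
  isIndependentSet?-∈-size0 w T′ with w ∈? T′
  ... | yes w∈T = ¬T⇒≡false λ h → card≡0⇒∉ (size (isIndependentSet?-sound h)) w∈T
  ... | no _    = refl

  isIndependentSet?-∈ : ∀ {S j w} → w ∉ S → ∀ T′ →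
    isYes (w ∈? T′) ∧ isIndependentSet? S (suc j) T′ ≡ isIndependentSet? (S ∪ closedNeighbours w) j (toggle w T′)
  isIndependentSet?-∈ {w = w} w∉S T′ with w ∈? T′
  ... | yes w∈T = T-injective (mk⇔
    (isIndependentSet?-complete ∘ IsIndependentSet-toggle⁺ w∈T ∘ isIndependentSet?-sound)
    (isIndependentSet?-complete ∘ proj₂ ∘ IsIndependentSet-toggle⁻ w∉S ∘ isIndependentSet?-sound))
  ... | no w∉T  = sym (¬T⇒≡false (w∉T ∘ proj₁ ∘ IsIndependentSet-toggle⁻ w∉S ∘ isIndependentSet?-sound))

  contracted : Subset n → Fin n → ℕ → ℕ
  contracted S w zero    = 0
  contracted S w (suc j) = indepCount G (S ∪ closedNeighbours w) j

  indepCount-deletion : ∀ {S w} k → w ∉ S →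
    indepCount G S k ≡ indepCount G (S ∪ ⁅ w ⁆) k ℕ.+ contracted S w k
  indepCount-deletion {S} {w} k w∉S = begin
    indepCount G S k
      ≡⟨ count-split (isYes ∘ (w ∈?_)) (isIndependentSet? S k) (allSubsets n) ⟩
    countSubsets n (λ T′ → not (isYes (w ∈? T′)) ∧ isIndependentSet? S k T′) ℕ.+
    countSubsets n (λ T′ → isYes (w ∈? T′) ∧ isIndependentSet? S k T′)
      ≡⟨ cong₂ ℕ._+_ (count-cong (allSubsets n) (isIndependentSet?-∉ w)) (containing k) ⟩
    indepCount G (S ∪ ⁅ w ⁆) k ℕ.+ contracted S w k
      ∎
    where
    open ≡-Reasoning
    containing : ∀ k → countSubsets n (λ T′ → isYes (w ∈? T′) ∧ isIndependentSet? S k T′) ≡ contracted S w k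
    containing zero    = count-none (allSubsets n) (isIndependentSet?-∈-size0 w)
    containing (suc j) = trans (count-cong (allSubsets n) (isIndependentSet?-∈ w∉S))
                               (countSubsets-toggle n w (isIndependentSet? (S ∪ closedNeighbours w) j))

  indepCount-full : ∀ {S w} → w ∈ S → indepCount G S n ≡ 0
  indepCount-full {S} {w} w∈S = count-none (allSubsets n) λ T′ → ¬T⇒≡false λ h →
    let is = isIndependentSet?-sound h
    in IsIndependentSet-∉ is w∈S (subst (w ∈_) (sym (∣p∣≡n⇒p≡⊤ (trans (sym (card≡∣∣ T′)) (size is)))) ∈⊤)

  indepCount-0 : ∀ S → 1 ≤ indepCount G S 0
  indepCount-0 S = countSubsets-∅ n (isIndependentSet? S 0) (isIndependentSet?-complete record
    { independent = λ u∈∅ → contradiction u∈∅ ∉⊥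
    ; disjoint    = λ i∈∅ → contradiction i∈∅ ∉⊥
    ; size        = trans (card≡∣∣ (∅ {n})) (∣⊥∣≡0 n) })

  neighbourList : Fin n → List (Fin n)
  neighbourList u = filterᵇ (adj G u) (allFin n)

  ∈-neighbourList⁺ : ∀ {u i} → adj G u i ≡ true → i ∈ₗ neighbourList u
  ∈-neighbourList⁺ {u} {i} adj≡ = ∈-filter⁺ (T? ∘ adj G u) (∈-allFin i) (Equivalence.from T-≡ adj≡)

  ∈-neighbourList⁻ : ∀ {u i} → i ∈ₗ neighbourList u → adj G u i ≡ true
  ∈-neighbourList⁻ {u} i∈ = Equivalence.to T-≡ (proj₂ (∈-filter⁻ (T? ∘ adj G u) {xs = allFin n} i∈))

  insertAll-neighbourList : ∀ u a → insertAll (neighbourList u) a ≡ a ∪ neighbours u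
  insertAll-neighbourList u a = ⊆-antisym forth back
    where
    forth : insertAll (neighbourList u) a ⊆ a ∪ neighbours u
    forth i∈ with ∈-insertAll⁻ (neighbourList u) i∈
    ... | inj₁ i∈a  = x∈p∪q⁺ (inj₁ i∈a)
    ... | inj₂ i∈ts = x∈p∪q⁺ (inj₂ (Equivalence.from ∈neighbours⇔adj (∈-neighbourList⁻ i∈ts)))
    back : a ∪ neighbours u ⊆ insertAll (neighbourList u) a
    back i∈ with x∈p∪q⁻ a (neighbours u) i∈
    ... | inj₁ i∈a = ∈-insertAll⁺ˡ (neighbourList u) i∈a
    ... | inj₂ i∈N = ∈-insertAll⁺ʳ (∈-neighbourList⁺ (Equivalence.to ∈neighbours⇔adj i∈N))

  data AvoidingWalk (S : Subset n) : Fin n → Fin n → Set where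
    end  : ∀ {u} → u ∉ S → AvoidingWalk S u u
    edge : ∀ {u w v} → u ∉ S → adj G u w ≡ true → AvoidingWalk S w v → AvoidingWalk S u v

  AvoidingWalk-source : ∀ {S u v} → AvoidingWalk S u v → u ∉ S
  AvoidingWalk-source (end u∉S)      = u∉S
  AvoidingWalk-source (edge u∉S _ _) = u∉S

  AvoidingWalk-anti-mono : ∀ {S S′ u v} → S ⊆ S′ → AvoidingWalk S′ u v → AvoidingWalk S u v
  AvoidingWalk-anti-mono S⊆S′ (end u∉S′)           = end (u∉S′ ∘ S⊆S′)
  AvoidingWalk-anti-mono S⊆S′ (edge u∉S′ adj walk) = edge (u∉S′ ∘ S⊆S′) adj (AvoidingWalk-anti-mono S⊆S′ walk)

  AvoidingWalk-lastExit : ∀ {S u a v} → v ≢ u → AvoidingWalk S a v →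
    AvoidingWalk (S ∪ ⁅ u ⁆) a v ⊎ ∃[ s ] (adj G u s ≡ true × AvoidingWalk (S ∪ ⁅ u ⁆) s v)
  AvoidingWalk-lastExit v≢u (end v∉S) = inj₁ (end (∉∪⁅⁆ v∉S v≢u))
  AvoidingWalk-lastExit {u = u} v≢u (edge {u = a} {w} a∉S adj-aw walk) with AvoidingWalk-lastExit v≢u walk
  ... | inj₂ exit = inj₂ exit
  ... | inj₁ walk′ with a ≟ u
  ...   | yes refl = inj₂ (w , adj-aw , walk′)
  ...   | no a≢u   = inj₁ (edge (∉∪⁅⁆ a∉S a≢u) adj-aw walk′)

  Walk⇒AvoidingWalk : ∀ {u v k} → Walk G u v k → AvoidingWalk ∅ u v
  Walk⇒AvoidingWalk nil             = end ∉⊥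
  Walk⇒AvoidingWalk (cons adj walk) = edge ∉⊥ adj (Walk⇒AvoidingWalk walk)

  AvoidingWalk⇒Walk : ∀ {S u v} → AvoidingWalk S u v → ∃ (Walk G u v)
  AvoidingWalk⇒Walk (end _)           = 0 , nil
  AvoidingWalk⇒Walk (edge _ adj walk) = let k , walk′ = AvoidingWalk⇒Walk walk in suc k , cons adj walk′

isOdd : ℕ → Bool
isOdd zero    = false
isOdd (suc k) = not (isOdd k)

%2≡1⇒isOdd : ∀ k → k % 2 ≡ 1 → isOdd k ≡ true
%2≡1⇒isOdd (suc zero)    _ = refl
%2≡1⇒isOdd (suc (suc k)) h = trans (not-involutive (isOdd k)) (%2≡1⇒isOdd k h)

%2≡0⇒¬isOdd : ∀ k → k % 2 ≡ 0 → isOdd k ≡ false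
%2≡0⇒¬isOdd zero          _ = refl
%2≡0⇒¬isOdd (suc (suc k)) h = trans (not-involutive (isOdd k)) (%2≡0⇒¬isOdd k h)

module ProperColouring (G : Graph n) (colour : Fin n → Bool)
  (proper : ∀ u v → adj G u v ≡ true → colour u ≢ colour v) where

  differ : Fin n → Fin n → Bool
  differ u v = colour u xor colour v

  differ-adj : ∀ {u t} v → adj G u t ≡ true → differ t v ≡ not (differ u v)
  differ-adj {u} {t} v adj-ut = trans (cong (_xor colour v) (¬-not (proper u t adj-ut ∘ sym)))
                                      (sym (not-distribˡ-xor (colour u) (colour v)))

  differ-Walk : ∀ {u v k} → Walk G u v k → differ u v ≡ isOdd k
  differ-Walk {u} nil = xor-same (colour u)
  differ-Walk {u} {v} (cons adj-uw walk) =
    trans (sym (not-involutive (differ u v))) (cong not (trans (sym (differ-adj v adj-uw)) (differ-Walk walk)))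

module OrderedCommRingProperties {c ℓ₁ ℓ₂} (R : OrderedCommRing c ℓ₁ ℓ₂) where

  open OrderedCommRing R hiding (zero) renaming (refl to ≈-refl; sym to ≈-sym; trans to ≈-trans)
  open IsStrictTotalOrder isStrictTotalOrder
    using (compare; irrefl; asym; <-respʳ-≈; <-respˡ-≈) renaming (trans to <-trans)
  open import Algebra.Properties.Ring ring using (-‿involutive; -‿distribʳ-*; x[y-z]≈xy-xz)
  open import Algebra.Properties.AbelianGroup +-abelianGroup using (⁻¹-∙-comm)
  open import Algebra.Properties.Semiring.Sum semiring using (sum)
  open import Algebra.Definitions.RawSemiring (Algebra.Bundles.Semiring.rawSemiring semiring)
    using (_^_) renaming (_×_ to _·_)
  open import Algebra.Properties.CommutativeSemigroup +-commutativeSemigroup using (interchange)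
  open import Algebra.Solver.Ring.NaturalCoefficients.Default commutativeSemiring
  open import Relation.Binary.Reasoning.Setoid setoid

  Signed : Bool → Carrier → Set ℓ₂
  Signed true  y = 0# < y
  Signed false y = y < 0#

  WeaklySigned : Bool → Carrier → Set ℓ₂
  WeaklySigned b y = ¬ Signed (not b) y

  Signed-resp : ∀ b {y z} → y ≈ z → Signed b y → Signed b z
  Signed-resp true  = <-respʳ-≈
  Signed-resp false = <-respˡ-≈

  WeaklySigned-resp : ∀ b {y z} → y ≈ z → WeaklySigned b y → WeaklySigned b z
  WeaklySigned-resp b y≈z w s = w (Signed-resp (not b) (≈-sym y≈z) s)

  Signed-asym : ∀ b {y} → Signed b y → ¬ Signed (not b) y
  Signed-asym true  = asym
  Signed-asym false = asym

  Signed-≉0 : ∀ b {y} → Signed b y → ¬ y ≈ 0#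
  Signed-≉0 true  s y≈0 = irrefl (≈-sym y≈0) s
  Signed-≉0 false s y≈0 = irrefl y≈0 s

  Signed⇒WeaklySigned : ∀ b {y} → Signed b y → WeaklySigned b y
  Signed⇒WeaklySigned true  = asym
  Signed⇒WeaklySigned false = asym

  ≈0⇒WeaklySigned : ∀ b {y} → y ≈ 0# → WeaklySigned b y
  ≈0⇒WeaklySigned b y≈0 s = Signed-≉0 (not b) s y≈0

  trichotomy : ∀ b y → Signed b y ⊎ y ≈ 0# ⊎ Signed (not b) y
  trichotomy true y with compare 0# y
  ... | tri< 0<y _ _ = inj₁ 0<y
  ... | tri≈ _ 0≈y _ = inj₂ (inj₁ (≈-sym 0≈y))
  ... | tri> _ _ y<0 = inj₂ (inj₂ y<0)
  trichotomy false y with compare y 0#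
  ... | tri< y<0 _ _ = inj₁ y<0
  ... | tri≈ _ y≈0 _ = inj₂ (inj₁ y≈0)
  ... | tri> _ _ 0<y = inj₂ (inj₂ 0<y)

  WeaklySigned⇒Signed⊎≈0 : ∀ b {y} → WeaklySigned b y → Signed b y ⊎ y ≈ 0#
  WeaklySigned⇒Signed⊎≈0 b {y} w with trichotomy b y
  ... | inj₁ s          = inj₁ s
  ... | inj₂ (inj₁ y≈0) = inj₂ y≈0
  ... | inj₂ (inj₂ s)   = contradiction s w

  WeaklySigned-both⇒≈0 : ∀ b {y} → WeaklySigned b y → WeaklySigned (not b) y → y ≈ 0#
  WeaklySigned-both⇒≈0 true  w w′ with WeaklySigned⇒Signed⊎≈0 true w
  ... | inj₁ s   = contradiction s w′
  ... | inj₂ y≈0 = y≈0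
  WeaklySigned-both⇒≈0 false w w′ with WeaklySigned⇒Signed⊎≈0 false w
  ... | inj₁ s   = contradiction s w′
  ... | inj₂ y≈0 = y≈0

  -‿Signed : ∀ b {y} → Signed (not b) y → Signed b (- y)
  -‿Signed true  {y} y<0 = <-respˡ-≈ (-‿inverseʳ y) (<-respʳ-≈ (+-identityˡ (- y)) (+-mono-< (- y) y<0))
  -‿Signed false {y} 0<y = <-respʳ-≈ (-‿inverseʳ y) (<-respˡ-≈ (+-identityˡ (- y)) (+-mono-< (- y) 0<y))

  -‿Signed⁻ : ∀ b {y} → Signed (not b) (- y) → Signed b y
  -‿Signed⁻ b {y} s = Signed-resp b (-‿involutive y) (-‿Signed b s)

  -‿WeaklySigned : ∀ b {y} → WeaklySigned (not b) y → WeaklySigned b (- y)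
  -‿WeaklySigned true  w s = w (-‿Signed⁻ true s)
  -‿WeaklySigned false w s = w (-‿Signed⁻ false s)

  +-Signed : ∀ b {y z} → Signed b y → WeaklySigned b z → Signed b (y + z)
  +-Signed b {y} {z} s w with WeaklySigned⇒Signed⊎≈0 b w
  ... | inj₂ z≈0 = Signed-resp b (≈-sym (≈-trans (+-congˡ z≈0) (+-identityʳ y))) s
  +-Signed true  {y} {z} 0<y _ | inj₁ 0<z = <-trans 0<z (<-respˡ-≈ (+-identityˡ z) (+-mono-< z 0<y))
  +-Signed false {y} {z} y<0 _ | inj₁ z<0 = <-trans (<-respʳ-≈ (+-identityˡ z) (+-mono-< z y<0)) z<0

  +-WeaklySigned : ∀ b {y z} → WeaklySigned b y → WeaklySigned b z → WeaklySigned b (y + z)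
  +-WeaklySigned b {y} {z} w w′ with WeaklySigned⇒Signed⊎≈0 b w
  ... | inj₁ s   = Signed⇒WeaklySigned b (+-Signed b s w′)
  ... | inj₂ y≈0 = WeaklySigned-resp b (≈-sym (≈-trans (+-congʳ y≈0) (+-identityˡ z))) w′

  *-Signed : ∀ b {p y} → 0# < p → Signed b y → Signed b (p * y)
  *-Signed true  0<p 0<y = *-pos 0<p 0<y
  *-Signed false {p} {y} 0<p y<0 =
    -‿Signed⁻ false (Signed-resp true (≈-sym (-‿distribʳ-* p y)) (*-pos 0<p (-‿Signed true y<0)))

  *-Signed⁻ : ∀ b {p y} → 0# < p → Signed b (p * y) → Signed b y
  *-Signed⁻ b {p} {y} 0<p s with trichotomy b y
  ... | inj₁ s′          = s′
  ... | inj₂ (inj₁ y≈0)  = contradiction (≈-trans (*-congˡ y≈0) (zeroʳ p)) (Signed-≉0 b s)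
  ... | inj₂ (inj₂ s′)   = contradiction (*-Signed (not b) 0<p s′) (Signed-asym b s)

  *-WeaklySigned : ∀ b {p y} → 0# < p → WeaklySigned b y → WeaklySigned b (p * y)
  *-WeaklySigned b 0<p w s = w (*-Signed⁻ (not b) 0<p s)

  *-WeaklySigned⁻ : ∀ b {p y} → 0# < p → WeaklySigned b (p * y) → WeaklySigned b y
  *-WeaklySigned⁻ b 0<p w s = w (*-Signed (not b) 0<p s)

  0<1 : ∀ {x} → 0# < x → 0# < 1#
  0<1 {x} 0<x with trichotomy true 1#
  ... | inj₁ 0<1         = 0<1
  ... | inj₂ (inj₁ 1≈0)  = contradiction (≈-trans (≈-sym (*-identityʳ x)) (≈-trans (*-congˡ 1≈0) (zeroʳ x)))
                                          (Signed-≉0 true 0<x)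
  ... | inj₂ (inj₂ 1<0)  = contradiction (Signed-resp true -1*-1≈1 (*-pos (-‿Signed true 1<0) (-‿Signed true 1<0)))
                                          (asym 1<0)
    where
    -1*-1≈1 : - 1# * - 1# ≈ 1#
    -1*-1≈1 = ≈-trans (≈-sym (-‿distribʳ-* (- 1#) 1#)) (≈-trans (-‿cong (*-identityʳ (- 1#))) (-‿involutive 1#))

  0<^ : ∀ {x} → 0# < x → ∀ k → 0# < (x ^ k)
  0<^ 0<x zero    = 0<1 0<x
  0<^ 0<x (suc k) = *-pos 0<x (0<^ 0<x k)

  ·-nonneg : ∀ m {y} → WeaklySigned true y → WeaklySigned true (m · y)
  ·-nonneg zero    w = ≈0⇒WeaklySigned true ≈-refl
  ·-nonneg (suc m) w = +-WeaklySigned true w (·-nonneg m w)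

  ·-pos : ∀ {m y} → 1 ≤ m → 0# < y → 0# < (m · y)
  ·-pos {suc m} (s≤s _) 0<y = +-Signed true 0<y (·-nonneg m (Signed⇒WeaklySigned true 0<y))

  sum-nonneg : ∀ {n} (f : Vector Carrier n) → (∀ i → WeaklySigned true (f i)) → WeaklySigned true (sum f)
  sum-nonneg {zero}  f _  = ≈0⇒WeaklySigned true ≈-refl
  sum-nonneg {suc n} f f≥0 = +-WeaklySigned true (f≥0 zero) (sum-nonneg (f ∘ suc) (f≥0 ∘ suc))

  -- The semiring solver cannot cancel additive inverses, so identities involving subtraction
  -- are proved with the subtracted terms moved to the other side.
  x+w≈z+y⇒x-y≈z-w : ∀ {x y z w} → x + w ≈ z + y → x - y ≈ z - w
  x+w≈z+y⇒x-y≈z-w {x} {y} {z} {w} x+w≈z+y = begin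
    x - y                ≈⟨ +-identityʳ (x - y) ⟨
    (x - y) + 0#         ≈⟨ +-congˡ (-‿inverseʳ w) ⟨
    (x - y) + (w - w)    ≈⟨ interchange x (- y) w (- w) ⟩
    (x + w) + (- y - w)  ≈⟨ +-congʳ x+w≈z+y ⟩
    (z + y) + (- y - w)  ≈⟨ +-congˡ (+-comm (- y) (- w)) ⟩
    (z + y) + (- w - y)  ≈⟨ interchange z y (- w) (- y) ⟩
    (z - w) + (y - y)    ≈⟨ +-congˡ (-‿inverseʳ y) ⟩
    (z - w) + 0#         ≈⟨ +-identityʳ (z - w) ⟩
    z - w                ∎

  [x+y]-[z+w]≈[x-z]+[y-w] : ∀ x y z w → (x + y) - (z + w) ≈ (x - z) + (y - w)
  [x+y]-[z+w]≈[x-z]+[y-w] x y z w = ≈-trans (+-congˡ (≈-sym (⁻¹-∙-comm z w))) (interchange x y (- z) (- w))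

  x[y+zw]-[x+zu]y≈z[xw-uy] : ∀ x y z w u → x * (y + z * w) - (x + z * u) * y ≈ z * (x * w - u * y)
  x[y+zw]-[x+zu]y≈z[xw-uy] x y z w u = begin
    x * (y + z * w) - (x + z * u) * y
      ≈⟨ x+w≈z+y⇒x-y≈z-w (solve 5 (λ x y z w u → x :* (y :+ z :* w) :+ z :* (u :* y)
                                                := z :* (x :* w) :+ (x :+ z :* u) :* y) ≈-refl x y z w u) ⟩
    z * (x * w) - z * (u * y) ≈⟨ x[y-z]≈xy-xz z (x * w) (u * y) ⟨
    z * (x * w - u * y)       ∎

  xx-[x+zw]x≈-[z[xw]] : ∀ x z w → x * x - (x + z * w) * x ≈ - (z * (x * w))
  xx-[x+zw]x≈-[z[xw]] x z w = begin
    x * x - (x + z * w) * x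
      ≈⟨ x+w≈z+y⇒x-y≈z-w (solve 3 (λ x z w → x :* x :+ z :* (x :* w) := con 0 :+ (x :+ z :* w) :* x) ≈-refl x z w) ⟩
    0# - z * (x * w) ≈⟨ +-identityˡ _ ⟩
    - (z * (x * w))  ∎

  -- cross a b is positive when the ratio g/f strictly increases from a to b; as f > 0, cross-split
  -- makes this comparison transitive.
  module CrossDifference {A : Set} (f g : A → Carrier) (f-pos : ∀ a → 0# < f a) where

    cross : A → A → Carrier
    cross a b = f a * g b - f b * g a

    cross-refl : ∀ a → cross a a ≈ 0#
    cross-refl a = -‿inverseʳ (f a * g a)

    cross-split : ∀ a b c → f b * cross a c ≈ f c * cross a b + f a * cross b c
    cross-split a b c = begin
      f b * (f a * g c - f c * g a)
        ≈⟨ x[y-z]≈xy-xz (f b) _ _ ⟩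
      f b * (f a * g c) - f b * (f c * g a)
        ≈⟨ x+w≈z+y⇒x-y≈z-w (solve 6 (λ fa fb fc ga gb gc →
             fb :* (fa :* gc) :+ (fc :* (fb :* ga) :+ fa :* (fc :* gb))
             := (fc :* (fa :* gb) :+ fa :* (fb :* gc)) :+ fb :* (fc :* ga)) ≈-refl (f a) (f b) (f c) (g a) (g b) (g c)) ⟩
      (f c * (f a * g b) + f a * (f b * g c)) - (f c * (f b * g a) + f a * (f c * g b))
        ≈⟨ [x+y]-[z+w]≈[x-z]+[y-w] _ _ _ _ ⟩
      (f c * (f a * g b) - f c * (f b * g a)) + (f a * (f b * g c) - f a * (f c * g b))
        ≈⟨ +-cong (x[y-z]≈xy-xz (f c) _ _) (x[y-z]≈xy-xz (f a) _ _) ⟨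
      f c * cross a b + f a * cross b c
        ∎

    cross-WeaklySigned-trans : ∀ s {a b c} → WeaklySigned s (cross a b) → WeaklySigned s (cross b c) →
                               WeaklySigned s (cross a c)
    cross-WeaklySigned-trans s {a} {b} {c} ab bc = *-WeaklySigned⁻ s (f-pos b)
      (WeaklySigned-resp s (≈-sym (cross-split a b c))
        (+-WeaklySigned s (*-WeaklySigned s (f-pos c) ab) (*-WeaklySigned s (f-pos a) bc)))

    cross-Signed-trans : ∀ s {a b c} → Signed s (cross a b) → WeaklySigned s (cross b c) → Signed s (cross a c)
    cross-Signed-trans s {a} {b} {c} ab bc = *-Signed⁻ s (f-pos b)
      (Signed-resp s (≈-sym (cross-split a b c))
        (+-Signed s (*-Signed s (f-pos c) ab) (*-WeaklySigned s (f-pos a) bc)))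

module IndependencePolynomial {c ℓ₁ ℓ₂} (R : OrderedCommRing c ℓ₁ ℓ₂) {n} (G : Graph n)
  (x : OrderedCommRing.Carrier R) (0<x : OrderedCommRing._<_ R (OrderedCommRing.0# R) x) where

  open OrderedCommRing R hiding (zero) renaming (refl to ≈-refl; sym to ≈-sym; trans to ≈-trans)
  open OrderedCommRingProperties R
  open import Algebra.Properties.Semiring.Sum semiring
    using (sum; sum-cong-≋; sum-cong-≗; ∑-distrib-+; *-distribˡ-sum; sum-init-last)
  open import Algebra.Properties.Semiring.Mult semiring using (×-congˡ; ×-homo-+; ×-comm-*)
  open import Algebra.Definitions.RawSemiring (Algebra.Bundles.Semiring.rawSemiring semiring)
    using (_^_) renaming (_×_ to _·_)
  open import Relation.Binary.Reasoning.Setoid setoid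

  I : Subset n → Carrier
  I S = indepPoly R G S x

  term : Subset n → ℕ → Carrier
  term S k = indepCount G S k · (x ^ k)

  sumUpTo : ℕ → (ℕ → Carrier) → Carrier
  sumUpTo m f = sum {m} (f ∘ toℕ)

  foldr-applyUpTo : ∀ (g : ℕ → Carrier) f m → foldr _+_ 0# (map g (applyUpTo f m)) ≡ sumUpTo m (g ∘ f)
  foldr-applyUpTo g f zero    = ≡.refl
  foldr-applyUpTo g f (suc m) = ≡.cong (g (f 0) +_) (foldr-applyUpTo g (f ∘ suc) m)

  I≡sumUpTo : ∀ S → I S ≡ sumUpTo (suc n) (term S)
  I≡sumUpTo S = foldr-applyUpTo (term S) (λ k → k) (suc n)

  I-pos : ∀ S → 0# < I S
  I-pos S = ≡.subst (0# <_) (≡.sym (I≡sumUpTo S))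
    (+-Signed true (·-pos (indepCount-0 G S) (0<^ 0<x 0)) (sum-nonneg {n} _ λ k →
      ·-nonneg (indepCount G S (suc (toℕ k))) (Signed⇒WeaklySigned true (0<^ 0<x (suc (toℕ k))))))

  I≈sumUpTo : ∀ {S w} → w ∈ S → I S ≈ sumUpTo n (term S)
  I≈sumUpTo {S} {w} w∈S = begin
    I S                                       ≡⟨ I≡sumUpTo S ⟩
    sumUpTo (suc n) (term S)                  ≈⟨ sum-init-last {n} (term S ∘ toℕ) ⟩
    sum {n} (term S ∘ toℕ ∘ inject₁) + term S (toℕ (fromℕ n))
      ≡⟨ ≡.cong₂ _+_ (sum-cong-≗ {n} (≡.cong (term S) ∘ toℕ-inject₁)) (≡.cong (term S) (toℕ-fromℕ n)) ⟩
    sumUpTo n (term S) + term S n             ≡⟨ ≡.cong (λ m → sumUpTo n (term S) + m · (x ^ n)) (indepCount-full G w∈S) ⟩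
    sumUpTo n (term S) + 0#                   ≈⟨ +-identityʳ _ ⟩
    sumUpTo n (term S)                        ∎

  I-deletion : ∀ {S w} → w ∉ S → I S ≈ I (S ∪ ⁅ w ⁆) + x * I (S ∪ closedNeighbours G w)
  I-deletion {S} {w} w∉S = begin
    I S                                                       ≡⟨ I≡sumUpTo S ⟩
    sumUpTo (suc n) (term S)                                  ≈⟨ sum-cong-≋ {suc n} (split ∘ toℕ) ⟩
    sumUpTo (suc n) (λ k → term S⁻ k + contracted G S w k · (x ^ k))
      ≈⟨ ∑-distrib-+ {suc n} (term S⁻ ∘ toℕ) (λ k → contracted G S w (toℕ k) · (x ^ toℕ k)) ⟩
    sumUpTo (suc n) (term S⁻) + (0# + sumUpTo n (λ k → indepCount G S⁺ k · (x * x ^ k)))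
      ≈⟨ +-cong (reflexive (≡.sym (I≡sumUpTo S⁻))) (+-identityˡ _) ⟩
    I S⁻ + sumUpTo n (λ k → indepCount G S⁺ k · (x * x ^ k))
      ≈⟨ +-congˡ (sum-cong-≋ {n} λ k → ×-comm-* (indepCount G S⁺ (toℕ k)) x (x ^ toℕ k)) ⟨
    I S⁻ + sumUpTo n (λ k → x * term S⁺ k)                    ≈⟨ +-congˡ (*-distribˡ-sum {n} x (term S⁺ ∘ toℕ)) ⟨
    I S⁻ + x * sumUpTo n (term S⁺)                            ≈⟨ +-congˡ (*-congˡ (I≈sumUpTo w∈S⁺)) ⟨
    I S⁻ + x * I S⁺                                           ∎
    where
    S⁻ = S ∪ ⁅ w ⁆
    S⁺ = S ∪ closedNeighbours G w
    w∈S⁺ : w ∈ S⁺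
    w∈S⁺ = x∈p∪q⁺ (inj₂ (w∈closedNeighbours G w))
    split : ∀ k → term S k ≈ term S⁻ k + contracted G S w k · (x ^ k)
    split k = ≈-trans (×-congˡ (indepCount-deletion G k w∉S))
                      (×-homo-+ (x ^ k) (indepCount G S⁻ k) (contracted G S w k))

module SignOfΔ {c ℓ₁ ℓ₂} (R : OrderedCommRing c ℓ₁ ℓ₂) {n} (G : Graph n)
  (colour : Fin n → Bool) (proper : ∀ u v → adj G u v ≡ true → colour u ≢ colour v)
  (x : OrderedCommRing.Carrier R) (0<x : OrderedCommRing._<_ R (OrderedCommRing.0# R) x) where

  open OrderedCommRing R hiding (zero) renaming (refl to ≈-refl; sym to ≈-sym; trans to ≈-trans)
  open OrderedCommRingProperties R
  open IndependencePolynomial R G x 0<x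
  open import Algebra.Properties.AbelianGroup +-abelianGroup using (⁻¹-anti-homo‿-)
  open import Algebra.Properties.Ring ring using (-0#≈0#)
  open import Relation.Binary.Reasoning.Setoid setoid

  Δ : Subset n → Fin n → Fin n → Carrier
  Δ S u v = I (S ∪ ⁅ u ⁆) * I (S ∪ ⁅ v ⁆) - I S * I ((S ∪ ⁅ u ⁆) ∪ ⁅ v ⁆)

  open ProperColouring G colour proper

  record SignPattern (S : Subset n) (u v : Fin n) : Set (ℓ₁ ⊔ ℓ₂) where
    field
      weakly    : WeaklySigned (differ u v) (Δ S u v)
      connected : AvoidingWalk G S u v → Signed (differ u v) (Δ S u v)
      separated : ¬ AvoidingWalk G S u v → Δ S u v ≈ 0#

  open SignPattern

  SignPattern-∈ : ∀ {S u} v → u ∈ S → SignPattern S u v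
  SignPattern-∈ {S} {u} v u∈S = record
    { weakly    = ≈0⇒WeaklySigned (differ u v) Δ≈0
    ; connected = λ walk → contradiction u∈S (AvoidingWalk-source G walk)
    ; separated = λ _ → Δ≈0 }
    where
    Δ≈0 : Δ S u v ≈ 0#
    Δ≈0 = begin
      Δ S u v                           ≡⟨ ≡.cong (λ S′ → I S′ * I (S ∪ ⁅ v ⁆) - I S * I (S′ ∪ ⁅ v ⁆)) (∈⇒∪⁅⁆≡ u∈S) ⟩
      I S * I (S ∪ ⁅ v ⁆) - I S * I (S ∪ ⁅ v ⁆) ≈⟨ -‿inverseʳ _ ⟩
      0#                                ∎

  SignPattern-diagonal : ∀ {S u} → u ∉ S → SignPattern S u u
  SignPattern-diagonal {S} {u} u∉S = record
    { weakly    = Signed⇒WeaklySigned (differ u u) negative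
    ; connected = λ _ → negative
    ; separated = λ no-walk → contradiction (end u∉S) no-walk }
    where
    Δ≈ : Δ S u u ≈ - (x * (I (S ∪ ⁅ u ⁆) * I (S ∪ closedNeighbours G u)))
    Δ≈ = begin
      Δ S u u
        ≡⟨ ≡.cong (λ S′ → I (S ∪ ⁅ u ⁆) * I (S ∪ ⁅ u ⁆) - I S * I S′) (∈⇒∪⁅⁆≡ (x∈p∪q⁺ (inj₂ (x∈⁅x⁆ u)))) ⟩
      I (S ∪ ⁅ u ⁆) * I (S ∪ ⁅ u ⁆) - I S * I (S ∪ ⁅ u ⁆)
        ≈⟨ +-congˡ (-‿cong (*-congʳ (I-deletion u∉S))) ⟩
      I (S ∪ ⁅ u ⁆) * I (S ∪ ⁅ u ⁆) - (I (S ∪ ⁅ u ⁆) + x * I (S ∪ closedNeighbours G u)) * I (S ∪ ⁅ u ⁆)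
        ≈⟨ xx-[x+zw]x≈-[z[xw]] _ _ _ ⟩
      - (x * (I (S ∪ ⁅ u ⁆) * I (S ∪ closedNeighbours G u)))
        ∎
    negative : Signed (differ u u) (Δ S u u)
    negative = ≡.subst (λ b → Signed b (Δ S u u)) (≡.sym (xor-same (colour u)))
      (Signed-resp false (≈-sym Δ≈) (-‿Signed false (*-pos 0<x (*-pos (I-pos _) (I-pos _)))))

  module Cross (v : Fin n) = CrossDifference I (λ a → I (a ∪ ⁅ v ⁆)) I-pos
  open Cross

  cross-insert : ∀ v a t → cross v a (a ∪ ⁅ t ⁆) ≈ - Δ a t v
  cross-insert v a t = ≈-sym (⁻¹-anti-homo‿- _ _)

  Δ-expansion : ∀ {S u v} → u ∉ S → u ≢ v →
    Δ S u v ≈ x * cross v (S ∪ ⁅ u ⁆) ((S ∪ ⁅ u ⁆) ∪ neighbours G u)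
  Δ-expansion {S} {u} {v} u∉S u≢v = begin
    Δ S u v                                 ≈⟨ +-cong (*-congˡ I[S∪v]≈) (-‿cong (*-congʳ I[S]≈)) ⟩
    f₀ * (g₀ + x * g₁) - (f₀ + x * f₁) * g₀ ≈⟨ x[y+zw]-[x+zu]y≈z[xw-uy] f₀ g₀ x g₁ f₁ ⟩
    x * cross v a₀ a₁                       ∎
    where
    N  = neighbours G u
    a₀ = S ∪ ⁅ u ⁆
    a₁ = a₀ ∪ N
    f₀ = I a₀
    g₀ = I (a₀ ∪ ⁅ v ⁆)
    f₁ = I a₁
    g₁ = I (a₁ ∪ ⁅ v ⁆)
    I[S]≈ : I S ≈ f₀ + x * f₁
    I[S]≈ = ≈-trans (I-deletion u∉S) (reflexive (≡.cong (λ T → f₀ + x * I T) (≡.sym (∪-assoc S ⁅ u ⁆ N))))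
    I[S∪v]≈ : I (S ∪ ⁅ v ⁆) ≈ g₀ + x * g₁
    I[S∪v]≈ = ≈-trans (I-deletion (∉∪⁅⁆ u∉S u≢v)) (reflexive (≡.cong₂ (λ T T′ → I T + x * I T′)
      (∪-swapʳ S ⁅ v ⁆ ⁅ u ⁆)
      (≡.trans (≡.sym (∪-assoc (S ∪ ⁅ v ⁆) ⁅ u ⁆ N))
               (≡.trans (≡.cong (_∪ N) (∪-swapʳ S ⁅ v ⁆ ⁅ u ⁆)) (∪-swapʳ a₀ ⁅ v ⁆ N)))))

  cross-insertAll : ∀ s v {a} ts → (∀ {a′ t} → a ⊆ a′ → t ∈ₗ ts → WeaklySigned s (cross v a′ (a′ ∪ ⁅ t ⁆))) →
                    WeaklySigned s (cross v a (insertAll ts a))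
  cross-insertAll s v []       step = ≈0⇒WeaklySigned s (cross-refl v _)
  cross-insertAll s v (t ∷ ts) step = cross-WeaklySigned-trans v s (step ⊆-refl (here ≡.refl))
    (cross-insertAll s v ts λ a∪t⊆a′ t∈ → step (⊆-trans (p⊆p∪q _) a∪t⊆a′) (there t∈))

  -- Δ S u v = x · cross v a₀ a₁, and a₁ arises from a₀ by inserting the neighbours t of u one at a time.
  -- Each insertion contributes −Δ a t v, which by induction has the sign opposite to differ t v = not σ.
  module OffDiagonal {S u v} (u∉S : u ∉ S) (u≢v : u ≢ v)
    (ih : ∀ {a} → S ∪ ⁅ u ⁆ ⊆ a → ∀ t → SignPattern a t v) where

    σ  = differ u v
    a₀ = S ∪ ⁅ u ⁆
    a₁ = a₀ ∪ neighbours G u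

    StepsSigned : Bool → Set ℓ₂
    StepsSigned s = ∀ {a t} → a₀ ⊆ a → adj G u t ≡ true → WeaklySigned s (cross v a (a ∪ ⁅ t ⁆))

    chain : ∀ s {a} → a₀ ⊆ a → StepsSigned s → WeaklySigned s (cross v a (a ∪ neighbours G u))
    chain s {a} a₀⊆a steps = ≡.subst (λ a′ → WeaklySigned s (cross v a a′)) (insertAll-neighbourList G u a)
      (cross-insertAll s v (neighbourList G u) λ a⊆a′ t∈ → steps (⊆-trans a₀⊆a a⊆a′) (∈-neighbourList⁻ G t∈))

    steps-weakly : StepsSigned σ
    steps-weakly {a} {t} a₀⊆a adj-ut = WeaklySigned-resp σ (≈-sym (cross-insert v a t)) (-‿WeaklySigned σ
      (≡.subst (λ b → WeaklySigned b (Δ a t v)) (differ-adj v adj-ut) (weakly (ih a₀⊆a t))))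

    steps-separated : ¬ AvoidingWalk G S u v → ∀ s → StepsSigned s
    steps-separated no-walk s {a} {t} a₀⊆a adj-ut = ≈0⇒WeaklySigned s (≈-trans (cross-insert v a t)
      (≈-trans (-‿cong (separated (ih a₀⊆a t) (no-walk ∘ edge u∉S adj-ut ∘ AvoidingWalk-anti-mono G S⊆a))) -0#≈0#))
      where
      S⊆a : S ⊆ a
      S⊆a = ⊆-trans (p⊆p∪q ⁅ u ⁆) a₀⊆a

    expansion : Δ S u v ≈ x * cross v a₀ a₁
    expansion = Δ-expansion u∉S u≢v

    connected-case : AvoidingWalk G S u v → Signed σ (Δ S u v)
    connected-case walk with AvoidingWalk-lastExit G (u≢v ∘ ≡.sym) walk
    ... | inj₁ walk′ = contradiction (x∈p∪q⁺ (inj₂ (x∈⁅x⁆ u))) (AvoidingWalk-source G walk′)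
    ... | inj₂ (s , adj-us , walk′) =
      Signed-resp σ (≈-sym expansion) (*-Signed σ 0<x (cross-Signed-trans v σ first rest))
      where
      -- the walk leaves u for the last time through s; inserting s first makes the first step strict
      first : Signed σ (cross v a₀ (a₀ ∪ ⁅ s ⁆))
      first = Signed-resp σ (≈-sym (cross-insert v a₀ s)) (-‿Signed σ
        (≡.subst (λ b → Signed b (Δ a₀ s v)) (differ-adj v adj-us) (connected (ih ⊆-refl s) walk′)))
      rest : WeaklySigned σ (cross v (a₀ ∪ ⁅ s ⁆) a₁)
      rest = ≡.subst (λ a′ → WeaklySigned σ (cross v (a₀ ∪ ⁅ s ⁆) a′))
        (≡.trans (∪-swapʳ a₀ ⁅ s ⁆ (neighbours G u))
                 (∈⇒∪⁅⁆≡ (x∈p∪q⁺ (inj₂ (Equivalence.from (∈neighbours⇔adj G) adj-us)))))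
        (chain σ (p⊆p∪q ⁅ s ⁆) steps-weakly)

    signPattern-offDiagonal : SignPattern S u v
    signPattern-offDiagonal = record
      { weakly    = WeaklySigned-resp σ (≈-sym expansion) (*-WeaklySigned σ 0<x (chain σ ⊆-refl steps-weakly))
      ; connected = connected-case
      ; separated = λ no-walk → ≈-trans expansion (≈-trans (*-congˡ (WeaklySigned-both⇒≈0 σ
          (chain σ ⊆-refl (steps-separated no-walk σ)) (chain (not σ) ⊆-refl (steps-separated no-walk (not σ)))))
          (zeroʳ x)) }

  signPattern : ∀ S u v → SignPattern S u v
  signPattern = All.wfRec ⊃-wellFounded _ (λ S → ∀ u v → SignPattern S u v) step
    where
    step : ∀ S → (∀ {S′} → S′ ⊃ S → ∀ u v → SignPattern S′ u v) → ∀ u v → SignPattern S u v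
    step S ih u v with u ∈? S | u ≟ v
    ... | yes u∈S | _          = SignPattern-∈ v u∈S
    ... | no u∉S  | yes ≡.refl = SignPattern-diagonal u∉S
    ... | no u∉S  | no u≢v     = OffDiagonal.signPattern-offDiagonal u∉S u≢v λ {a} a₀⊆a t →
      ih (⊆-trans (p⊆p∪q ⁅ u ⁆) a₀⊆a , u , a₀⊆a (x∈p∪q⁺ (inj₂ (x∈⁅x⁆ u))) , u∉S) t v

corollary1p1 : ∀ {c ℓ₁ ℓ₂ : Level} (R : OrderedCommRing c ℓ₁ ℓ₂) (n : ℕ) (G : Graph n) →
    Bipartite G → (u v : Fin n) → (x : OrderedCommRing.Carrier R) →
    OrderedCommRing._<_ R (OrderedCommRing.0# R) x →
    let open OrderedCommRing R
        I = indepPoly R G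
        Δ = (I ⁅ u ⁆ x * I ⁅ v ⁆ x) - (I ∅ x * I (⁅ u ⁆ ∪ ⁅ v ⁆) x)
    in ((∀ d → Dist G u v d → d % 2 ≡ 1 → 0# < Δ)
        × (DistInfinite G u v → Δ ≈ 0#))
        × (∀ d → Dist G u v d → d % 2 ≡ 0 → Δ < 0#)
corollary1p1 R n G (colour , proper) u v x 0<x =
  ( (λ d dist d%2≡1 → connected-with-parity (proj₁ dist) (%2≡1⇒isOdd d d%2≡1))
  , λ no-walk → subst (_≈ 0#) Δ∅≡Δ (separated Δ-signs (no-walk ∘ AvoidingWalk⇒Walk G)))
  , λ d dist d%2≡0 → connected-with-parity (proj₁ dist) (%2≡0⇒¬isOdd d d%2≡0)
  where
  open OrderedCommRing R
  open OrderedCommRingProperties R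
  open IndependencePolynomial R G x 0<x
  open ProperColouring G colour proper
  open SignOfΔ R G colour proper x 0<x
  open SignPattern
  Δ-signs : SignPattern ∅ u v
  Δ-signs = signPattern ∅ u v
  Δ∅≡Δ : Δ ∅ u v ≡ (I ⁅ u ⁆ * I ⁅ v ⁆ - I ∅ * I (⁅ u ⁆ ∪ ⁅ v ⁆))
  Δ∅≡Δ = cong₂ (λ S S′ → I S * I S′ - I ∅ * I (S ∪ ⁅ v ⁆)) (∪-identityˡ ⁅ u ⁆) (∪-identityˡ ⁅ v ⁆)
  connected-with-parity : ∀ {d b} → Walk G u v d → isOdd d ≡ b → Signed b (I ⁅ u ⁆ * I ⁅ v ⁆ - I ∅ * I (⁅ u ⁆ ∪ ⁅ v ⁆))
  connected-with-parity {d} walk refl = subst (Signed (isOdd d)) Δ∅≡Δ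
    (subst (λ b → Signed b (Δ ∅ u v)) (differ-Walk walk) (connected Δ-signs (Walk⇒AvoidingWalk G walk)))
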